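{- Let $E$ be either $\equiv_{CS}$ or $\equiv_o$. If $t_0\,E\,t_1$, $t_0\to_{\lambda j/E}^* u_0$ and $t_1\to_{\lambda j/E}^* u_1$, then there exist $v_0,v_1$ such that $u_0\to_{\lambda j/E}^* v_0$, $u_1\to_{\lambda j/E}^* v_1$ and $v_0\,E\,v_1$.
   Context: $\lambda j$-terms: $t,u ::= x \mid \lambda x.t \mid t\,u \mid t[x/u]$; $[x/u]$ is a jump, $\lambda x.t$ and $t[x/u]$ bind $x$ in $t$ (not in $u$), terms modulo $\alpha$-conversion. $\mathrm{fv}(t)$ free variables, $|t|_x$ number of free occurrences of $x$ in $t$, $t\{x/u\}$ capture-avoiding meta-level substitution. When $|t|_x\ge2$, $t_{[y]_x}$ is any term obtained by renaming $i$ free occurrences of $x$ into a fresh $y$, $1\le i\le|t|_x-1$. Rules: (dB) $(\lambda x.t)L\,u\mapsto t[x/u]L$, $L=[y_1/w_1]\dots[y_k/w_k]$ a possibly empty list of jumps with $\{y_1,\dots,y_k\}\cap\mathrm{fv}(u)=\emptyset$; (w) $t[x/u]\mapsto t$ if $|t|_x=0$; (d) $t[x/u]\mapsto t\{x/u\}$ if $|t|_x=1$; (c) $t[x/u]\mapsto t_{[y]_x}[x/u][y/u]$ if $|t|_x>1$, $y$ fresh; $\to_{\lambda j}$ is their contextual closure. $\equiv_{CS}$ is the smallest equivalence closed under contexts containing $t[x/s][y/v]\sim t[y/v][x/s]$ whenever $x\notin\mathrm{fv}(v)$, $y\notin\mathrm{fv}(s)$; $\equiv_o$ additionally contains $\lambda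 y.(t[x/s])\sim(\lambda y.t)[x/s]$ if $y\notin\mathrm{fv}(s)$ and $t[x/s]\,v\sim(t\,v)[x/s]$ if $x\notin\mathrm{fv}(v)$. $t\to_{\lambda j/E}u$ iff $t\,E\,t'\to_{\lambda j}u'\,E\,u$ for some $t',u'$. -}

module Defs where

-- λj-calculus with jumps, terms modulo α-conversion represented by
-- (unscoped) de Bruijn indices.

open import Data.Nat using (ℕ; zero; suc; _+_; _<_; _≤_)
open import Data.Bool using (if_then_else_)
open import Data.Nat using (_≡ᵇ_)
open import Data.List using (List; []; _∷_; length)
open import Data.Product using (Σ; _×_; _,_; ∃-syntax)
open import Relation.Binary.PropositionalEquality using (_≡_)
open import Relation.Binary.Construct.Closure.ReflexiveTransitive using (Star)

infixl 7 _·_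
infix 8 _[_]₀
infix 4 _↦_ _⟶_

data Tm : Set where
  var : ℕ → Tm
  ƛ_  : Tm → Tm
  _·_ : Tm → Tm → Tm
  jmp : Tm → Tm → Tm     -- jmp t u = t[x/u] : x is index 0 in t, not bound in u

ext : (ℕ → ℕ) → ℕ → ℕ
ext ρ zero    = zero
ext ρ (suc n) = suc (ρ n)

ren : (ℕ → ℕ) → Tm → Tm
ren ρ (var x)    = var (ρ x)
ren ρ (ƛ t)      = ƛ ren (ext ρ) t
ren ρ (t · u)    = ren ρ t · ren ρ u
ren ρ (jmp t u)  = jmp (ren (ext ρ) t) (ren ρ u)

shift : ℕ → Tm → Tm
shift k = ren (k +_)

swapV : ℕ → ℕ
swapV zero          = suc zero
swapV (suc zero)    = zero
swapV (suc (suc n)) = suc (suc n)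

swap : Tm → Tm
swap = ren swapV

exts : (ℕ → Tm) → ℕ → Tm
exts σ zero    = var zero
exts σ (suc n) = shift 1 (σ n)

subst : (ℕ → Tm) → Tm → Tm
subst σ (var x)   = σ x
subst σ (ƛ t)     = ƛ subst (exts σ) t
subst σ (t · u)   = subst σ t · subst σ u
subst σ (jmp t u) = jmp (subst (exts σ) t) (subst σ u)

σ₀ : Tm → ℕ → Tm
σ₀ u zero    = u
σ₀ u (suc n) = var n

_[_]₀ : Tm → Tm → Tm
t [ u ]₀ = subst (σ₀ u) t

occ : ℕ → Tm → ℕ
occ k (var x)   = if x ≡ᵇ k then 1 else 0
occ k (ƛ t)     = occ (suc k) t
occ k (t · u)   = occ k t + occ k u
occ k (jmp t u) = occ (suc k) t + occ k u

-- t_{[y]_x}: Split d t t' holds when t' is obtained from t by inserting a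
-- fresh variable y just above x (x = index d, y = index d+1 at depth d),
-- and renaming some (chosen) free occurrences of x into y.

data Split (d : ℕ) : Tm → Tm → Set where
  var<  : ∀ {x} → x < d → Split d (var x) (var x)
  varx  : Split d (var d) (var d)
  vary  : Split d (var d) (var (suc d))
  var>  : ∀ {x} → d < x → Split d (var x) (var (suc x))
  ƛ_    : ∀ {t t'} → Split (suc d) t t' → Split d (ƛ t) (ƛ t')
  _·_   : ∀ {t t' u u'} → Split d t t' → Split d u u' → Split d (t · u) (t' · u')
  jmp   : ∀ {t t' u u'} → Split (suc d) t t' → Split d u u' →
          Split d (jmp t u) (jmp t' u')

-- Lists of jumps: wrap (w₁ ∷ … ∷ wₖ ∷ []) t = t[y₁/w₁]…[yₖ/wₖ]

wrap : List Tm → Tm → Tm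
wrap []       t = t
wrap (w ∷ ws) t = wrap ws (jmp t w)

data _↦_ : Tm → Tm → Set where
  -- (dB) (λx.t)L u ↦ t[x/u]L  (u is moved under the k = |L| binders of L)
  dB : ∀ L t u → (wrap L (ƛ t)) · u ↦ wrap L (jmp t (shift (length L) u))
  -- (w) t[x/u] ↦ t  if |t|_x = 0  (t read in the outer scope, i.e. t{x/u})
  w  : ∀ {t} u → occ 0 t ≡ 0 → jmp t u ↦ t [ u ]₀
  d  : ∀ {t} u → occ 0 t ≡ 1 → jmp t u ↦ t [ u ]₀
  -- (c) t[x/u] ↦ t_{[y]_x}[x/u][y/u]  if |t|_x > 1, y fresh,
  --     renaming i occurrences with 1 ≤ i ≤ |t|_x - 1
  c  : ∀ {t t'} u → 1 < occ 0 t → Split 0 t t' →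
       1 ≤ occ 1 t' → 1 ≤ occ 0 t' →
       jmp t u ↦ jmp (jmp t' (shift 1 u)) u

data _⟶_ : Tm → Tm → Set where
  root : ∀ {t u} → t ↦ u → t ⟶ u
  ƛ_   : ∀ {t t'} → t ⟶ t' → ƛ t ⟶ ƛ t'
  appL : ∀ {t t' u} → t ⟶ t' → t · u ⟶ t' · u
  appR : ∀ {t u u'} → u ⟶ u' → t · u ⟶ t · u'
  jmpL : ∀ {t t' u} → t ⟶ t' → jmp t u ⟶ jmp t' u
  jmpR : ∀ {t u u'} → u ⟶ u' → jmp t u ⟶ jmp t u'

data Kind : Set where
  CS o : Kind

data Axiom : Kind → Tm → Tm → Set where
  -- t[x/s][y/v] ∼ t[y/v][x/s]   (x ∉ fv(v), y ∉ fv(s), x ≠ y)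
  cs  : ∀ {k} t s v →
        Axiom k (jmp (jmp t (shift 1 s)) v) (jmp (jmp (swap t) (shift 1 v)) s)
  -- λy.(t[x/s]) ∼ (λy.t)[x/s]   (y ∉ fv(s))
  lam : ∀ t s → Axiom o (ƛ jmp t (shift 1 s)) (jmp (ƛ swap t) s)
  -- t[x/s] v ∼ (t v)[x/s]        (x ∉ fv(v))
  app : ∀ t s v → Axiom o (jmp t s · v) (jmp (t · shift 1 v) s)

data Equiv (k : Kind) : Tm → Tm → Set where
  ax    : ∀ {t u} → Axiom k t u → Equiv k t u
  refl  : ∀ {t} → Equiv k t t
  sym   : ∀ {t u} → Equiv k t u → Equiv k u t
  trans : ∀ {t u v} → Equiv k t u → Equiv k u v → Equiv k t v
  ƛ_    : ∀ {t t'} → Equiv k t t' → Equiv k (ƛ t) (ƛ t')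
  appL  : ∀ {t t' u} → Equiv k t t' → Equiv k (t · u) (t' · u)
  appR  : ∀ {t u u'} → Equiv k u u' → Equiv k (t · u) (t · u')
  jmpL  : ∀ {t t' u} → Equiv k t t' → Equiv k (jmp t u) (jmp t' u)
  jmpR  : ∀ {t u u'} → Equiv k u u' → Equiv k (jmp t u) (jmp t u')

_⟶[_]_ : Tm → Kind → Tm → Set
t ⟶[ k ] u = ∃[ t' ] ∃[ u' ] (Equiv k t t' × t' ⟶ u' × Equiv k u' u)

_⟶*[_]_ : Tm → Kind → Tm → Set
t ⟶*[ k ] u = Star (λ a b → a ⟶[ k ] b) t u

-- Unfolding every jump, t[x/u] ↦ t{x/u}, sends a λj-step to a parallel β-step
-- and identifies E-equivalent terms (the axioms of ≡_CS and ≡_o only relocate jumps).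
-- Conversely a term λj-reduces to its unfolding (a jump with n occurrences is
-- eliminated by n - 1 (c)-steps and one (d)-step) and a parallel β-step is
-- simulated by dB followed by such an elimination.  Confluence of parallel
-- β-reduction then yields a common reduct v₀ = v₁ of the two unfoldings.
module Submission where

open import Defs
open import Data.Bool using (if_then_else_)
open import Data.List using (List; []; _∷_; length)
open import Data.Nat using (ℕ; zero; suc; _+_; _<_; _≤_; s≤s; z≤n)
open import Data.Nat.Properties
  using (_≟_; <-cmp; <⇒≢; >⇒≢; n<1+n; m<n⇒m<1+n; suc-injective; ≤-reflexive)
open import Data.Product using (_×_; ∃-syntax; _,_)
open import Function using (_∘_)
open import Function.Definitions using (Injective)
open import Relation.Binary.Definitions using (tri<; tri≈; tri>)
open import Relation.Binary.PropositionalEquality as P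
  using (_≡_; _≢_; refl; cong; cong₂; module ≡-Reasoning)
open import Relation.Binary.Construct.Closure.ReflexiveTransitive
  using (Star; ε; _◅_; _◅◅_; gmap)
open import Relation.Nullary using (yes; no)
open import Relation.Nullary.Decidable using (dec-true; dec-false)

ext-cong : ∀ {ρ ρ'} → (∀ x → ρ x ≡ ρ' x) → ∀ x → ext ρ x ≡ ext ρ' x
ext-cong h zero    = refl
ext-cong h (suc x) = cong suc (h x)

ren-cong : ∀ {ρ ρ'} → (∀ x → ρ x ≡ ρ' x) → ∀ t → ren ρ t ≡ ren ρ' t
ren-cong h (var x)   = cong var (h x)
ren-cong h (ƛ t)     = cong ƛ_ (ren-cong (ext-cong h) t)
ren-cong h (t · u)   = cong₂ _·_ (ren-cong h t) (ren-cong h u)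
ren-cong h (jmp t u) = cong₂ jmp (ren-cong (ext-cong h) t) (ren-cong h u)

exts-cong : ∀ {σ σ'} → (∀ x → σ x ≡ σ' x) → ∀ x → exts σ x ≡ exts σ' x
exts-cong h zero    = refl
exts-cong h (suc x) = cong (shift 1) (h x)

subst-cong : ∀ {σ σ'} → (∀ x → σ x ≡ σ' x) → ∀ t → subst σ t ≡ subst σ' t
subst-cong h (var x)   = h x
subst-cong h (ƛ t)     = cong ƛ_ (subst-cong (exts-cong h) t)
subst-cong h (t · u)   = cong₂ _·_ (subst-cong h t) (subst-cong h u)
subst-cong h (jmp t u) = cong₂ jmp (subst-cong (exts-cong h) t) (subst-cong h u)

ren-id : ∀ {ρ} → (∀ x → ρ x ≡ x) → ∀ t → ren ρ t ≡ t
ren-id h (var x)   = cong var (h x)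
ren-id h (ƛ t)     = cong ƛ_ (ren-id (λ { zero → refl ; (suc x) → cong suc (h x) }) t)
ren-id h (t · u)   = cong₂ _·_ (ren-id h t) (ren-id h u)
ren-id h (jmp t u) = cong₂ jmp (ren-id (λ { zero → refl ; (suc x) → cong suc (h x) }) t) (ren-id h u)

subst-id : ∀ {σ} → (∀ x → σ x ≡ var x) → ∀ t → subst σ t ≡ t
subst-id h (var x)   = h x
subst-id h (ƛ t)     = cong ƛ_ (subst-id (λ { zero → refl ; (suc x) → cong (shift 1) (h x) }) t)
subst-id h (t · u)   = cong₂ _·_ (subst-id h t) (subst-id h u)
subst-id h (jmp t u) = cong₂ jmp (subst-id (λ { zero → refl ; (suc x) → cong (shift 1) (h x) }) t) (subst-id h u)

ren-ren : ∀ ρ ρ' t → ren ρ (ren ρ' t) ≡ ren (ρ ∘ ρ') t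
ren-ren ρ ρ' (var x)   = refl
ren-ren ρ ρ' (ƛ t)     =
  cong ƛ_ (P.trans (ren-ren (ext ρ) (ext ρ') t) (ren-cong (λ { zero → refl ; (suc x) → refl }) t))
ren-ren ρ ρ' (t · u)   = cong₂ _·_ (ren-ren ρ ρ' t) (ren-ren ρ ρ' u)
ren-ren ρ ρ' (jmp t u) =
  cong₂ jmp (P.trans (ren-ren (ext ρ) (ext ρ') t) (ren-cong (λ { zero → refl ; (suc x) → refl }) t))
            (ren-ren ρ ρ' u)

ren-exts : ∀ ρ σ x → ren (ext ρ) (exts σ x) ≡ exts (ren ρ ∘ σ) x
ren-exts ρ σ zero    = refl
ren-exts ρ σ (suc x) = P.trans (ren-ren (ext ρ) suc (σ x)) (P.sym (ren-ren suc ρ (σ x)))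

ren-subst : ∀ ρ σ t → ren ρ (subst σ t) ≡ subst (ren ρ ∘ σ) t
ren-subst ρ σ (var x)   = refl
ren-subst ρ σ (ƛ t)     = cong ƛ_ (P.trans (ren-subst (ext ρ) (exts σ) t) (subst-cong (ren-exts ρ σ) t))
ren-subst ρ σ (t · u)   = cong₂ _·_ (ren-subst ρ σ t) (ren-subst ρ σ u)
ren-subst ρ σ (jmp t u) =
  cong₂ jmp (P.trans (ren-subst (ext ρ) (exts σ) t) (subst-cong (ren-exts ρ σ) t)) (ren-subst ρ σ u)

subst-ren : ∀ σ ρ t → subst σ (ren ρ t) ≡ subst (σ ∘ ρ) t
subst-ren σ ρ (var x)   = refl
subst-ren σ ρ (ƛ t)     =
  cong ƛ_ (P.trans (subst-ren (exts σ) (ext ρ) t) (subst-cong (λ { zero → refl ; (suc x) → refl }) t))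
subst-ren σ ρ (t · u)   = cong₂ _·_ (subst-ren σ ρ t) (subst-ren σ ρ u)
subst-ren σ ρ (jmp t u) =
  cong₂ jmp (P.trans (subst-ren (exts σ) (ext ρ) t) (subst-cong (λ { zero → refl ; (suc x) → refl }) t))
            (subst-ren σ ρ u)

subst-exts : ∀ σ τ x → subst (exts σ) (exts τ x) ≡ exts (subst σ ∘ τ) x
subst-exts σ τ zero    = refl
subst-exts σ τ (suc x) = P.trans (subst-ren (exts σ) suc (τ x)) (P.sym (ren-subst suc σ (τ x)))

subst-subst : ∀ σ τ t → subst σ (subst τ t) ≡ subst (subst σ ∘ τ) t
subst-subst σ τ (var x)   = refl
subst-subst σ τ (ƛ t)     =
  cong ƛ_ (P.trans (subst-subst (exts σ) (exts τ) t) (subst-cong (subst-exts σ τ) t))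
subst-subst σ τ (t · u)   = cong₂ _·_ (subst-subst σ τ t) (subst-subst σ τ u)
subst-subst σ τ (jmp t u) =
  cong₂ jmp (P.trans (subst-subst (exts σ) (exts τ) t) (subst-cong (subst-exts σ τ) t))
            (subst-subst σ τ u)

shift-[]₀ : ∀ t u → shift 1 t [ u ]₀ ≡ t
shift-[]₀ t u = P.trans (subst-ren (σ₀ u) suc t) (subst-id (λ _ → refl) t)

ren-[]₀ : ∀ ρ t u → ren ρ (t [ u ]₀) ≡ ren (ext ρ) t [ ren ρ u ]₀
ren-[]₀ ρ t u = P.trans (ren-subst ρ (σ₀ u) t) (P.sym (P.trans (subst-ren (σ₀ (ren ρ u)) (ext ρ) t)
  (subst-cong (λ { zero → refl ; (suc x) → refl }) t)))

subst-[]₀ : ∀ σ t u → subst σ (t [ u ]₀) ≡ subst (exts σ) t [ subst σ u ]₀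
subst-[]₀ σ t u = P.trans (subst-subst σ (σ₀ u) t) (P.sym (P.trans (subst-subst (σ₀ (subst σ u)) (exts σ) t)
  (subst-cong (λ { zero → refl ; (suc x) → shift-[]₀ (σ x) (subst σ u) }) t)))

[]₀-[]₀-swap : ∀ t s v → t [ shift 1 s ]₀ [ v ]₀ ≡ swap t [ shift 1 v ]₀ [ s ]₀
[]₀-[]₀-swap t s v = begin
  t [ shift 1 s ]₀ [ v ]₀                          ≡⟨ subst-subst (σ₀ v) (σ₀ (shift 1 s)) t ⟩
  subst (λ x → σ₀ (shift 1 s) x [ v ]₀) t          ≡⟨ subst-cong both-to-s,v t ⟩
  subst (λ x → σ₀ (shift 1 v) (swapV x) [ s ]₀) t  ≡⟨ subst-ren (_[ s ]₀ ∘ σ₀ (shift 1 v)) swapV t ⟨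
  subst (λ x → σ₀ (shift 1 v) x [ s ]₀) (swap t)   ≡⟨ subst-subst (σ₀ s) (σ₀ (shift 1 v)) (swap t) ⟨
  swap t [ shift 1 v ]₀ [ s ]₀                     ∎
  where
  open ≡-Reasoning
  both-to-s,v : ∀ x → σ₀ (shift 1 s) x [ v ]₀ ≡ σ₀ (shift 1 v) (swapV x) [ s ]₀
  both-to-s,v zero          = shift-[]₀ s v
  both-to-s,v (suc zero)    = P.sym (shift-[]₀ v s)
  both-to-s,v (suc (suc x)) = refl

[]₀-shift-swap : ∀ t s → t [ shift 1 s ]₀ ≡ subst (exts (σ₀ s)) (swap t)
[]₀-shift-swap t s =
  P.trans (subst-cong (λ { zero → refl ; (suc zero) → refl ; (suc (suc x)) → refl }) t)
          (P.sym (subst-ren (exts (σ₀ s)) swapV t))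

occ-var-≡ : ∀ k → occ k (var k) ≡ 1
occ-var-≡ k = cong (if_then 1 else 0) (dec-true (k ≟ k) refl)

occ-var-≢ : ∀ {x k} → x ≢ k → occ k (var x) ≡ 0
occ-var-≢ {x} {k} x≢k = cong (if_then 1 else 0) (dec-false (x ≟ k) x≢k)

ext-injective : ∀ {ρ} → Injective _≡_ _≡_ ρ → Injective _≡_ _≡_ (ext ρ)
ext-injective inj {zero}  {zero}  _  = refl
ext-injective inj {suc x} {suc y} eq = cong suc (inj (suc-injective eq))

occ-ren-injective : ∀ {ρ} → Injective _≡_ _≡_ ρ → ∀ k t → occ (ρ k) (ren ρ t) ≡ occ k t
occ-ren-injective {ρ} inj k (var x) with x ≟ k
... | yes refl = P.trans (occ-var-≡ (ρ k)) (P.sym (occ-var-≡ k))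
... | no x≢k   = P.trans (occ-var-≢ (x≢k ∘ inj)) (P.sym (occ-var-≢ x≢k))
occ-ren-injective inj k (ƛ t)     = occ-ren-injective (ext-injective inj) (suc k) t
occ-ren-injective inj k (t · u)   = cong₂ _+_ (occ-ren-injective inj k t) (occ-ren-injective inj k u)
occ-ren-injective inj k (jmp t u) =
  cong₂ _+_ (occ-ren-injective (ext-injective inj) (suc k) t) (occ-ren-injective inj k u)

ext-avoid : ∀ {ρ k} → (∀ x → ρ x ≢ k) → ∀ x → ext ρ x ≢ suc k
ext-avoid h zero    ()
ext-avoid h (suc x) eq = h x (suc-injective eq)

occ-ren-avoid : ∀ {ρ k} → (∀ x → ρ x ≢ k) → ∀ t → occ k (ren ρ t) ≡ 0
occ-ren-avoid h (var x)   = occ-var-≢ (h x)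
occ-ren-avoid h (ƛ t)     = occ-ren-avoid (ext-avoid h) t
occ-ren-avoid h (t · u)   = cong₂ _+_ (occ-ren-avoid h t) (occ-ren-avoid h u)
occ-ren-avoid h (jmp t u) = cong₂ _+_ (occ-ren-avoid (ext-avoid h) t) (occ-ren-avoid h u)

occ-exts : ∀ {σ k j} → (∀ x → occ k (σ x) ≡ occ j (var x)) →
           ∀ x → occ (suc k) (exts σ x) ≡ occ (suc j) (var x)
occ-exts h zero            = refl
occ-exts {σ} {k} h (suc x) = P.trans (occ-ren-injective suc-injective k (σ x)) (h x)

occ-subst : ∀ {σ} k j → (∀ x → occ k (σ x) ≡ occ j (var x)) → ∀ t → occ k (subst σ t) ≡ occ j t
occ-subst k j h (var x)   = h x
occ-subst k j h (ƛ t)     = occ-subst (suc k) (suc j) (occ-exts h) t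
occ-subst k j h (t · u)   = cong₂ _+_ (occ-subst k j h t) (occ-subst k j h u)
occ-subst k j h (jmp t u) = cong₂ _+_ (occ-subst (suc k) (suc j) (occ-exts h) t) (occ-subst k j h u)

split-none : ∀ δ t → ∃[ t' ] (Split δ t t' × occ (suc δ) t' ≡ 0 × occ δ t' ≡ occ δ t)
split-none δ (var x) with <-cmp x δ
... | tri< x<δ _ _ = var x , var< x<δ , occ-var-≢ (<⇒≢ (m<n⇒m<1+n x<δ)) , refl
... | tri≈ _ refl _ = var δ , varx , occ-var-≢ (<⇒≢ (n<1+n δ)) , refl
... | tri> _ _ δ<x =
  var (suc x) , var> δ<x , occ-var-≢ (>⇒≢ (s≤s δ<x)) ,
  P.trans (occ-var-≢ (>⇒≢ (m<n⇒m<1+n δ<x))) (P.sym (occ-var-≢ (>⇒≢ δ<x)))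
split-none δ (ƛ t) with split-none (suc δ) t
... | t' , sp , occ-y , occ-x = ƛ t' , ƛ sp , occ-y , occ-x
split-none δ (t · u) with split-none δ t | split-none δ u
... | t' , sp , occ-y , occ-x | u' , sp' , occ-y' , occ-x' =
  t' · u' , sp · sp' , cong₂ _+_ occ-y occ-y' , cong₂ _+_ occ-x occ-x'
split-none δ (jmp t u) with split-none (suc δ) t | split-none δ u
... | t' , sp , occ-y , occ-x | u' , sp' , occ-y' , occ-x' =
  jmp t' u' , jmp sp sp' , cong₂ _+_ occ-y occ-y' , cong₂ _+_ occ-x occ-x'

OneSplit : ℕ → Tm → ℕ → Set
OneSplit δ t m = ∃[ t' ] (Split δ t t' × occ (suc δ) t' ≡ 1 × occ δ t' ≡ m)

split-one : ∀ δ t m → occ δ t ≡ suc m → OneSplit δ t m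
split-one δ (var x) m eq with x ≟ δ
... | yes refl = var (suc δ) , vary , occ-var-≡ (suc δ) ,
      P.trans (occ-var-≢ (>⇒≢ (n<1+n δ))) (suc-injective (P.trans (P.sym (occ-var-≡ δ)) eq))
... | no x≢δ with () ← P.trans (P.sym (occ-var-≢ x≢δ)) eq
split-one δ (ƛ t) m eq with split-one (suc δ) t m eq
... | t' , sp , occ-y , occ-x = ƛ t' , ƛ sp , occ-y , occ-x
split-one δ (t · u) m eq with occ δ t in occ-t
... | zero with split-none δ t | split-one δ u m eq
...   | t' , sp , occ-y , occ-x | u' , sp' , occ-y' , occ-x' =
  t' · u' , sp · sp' , cong₂ _+_ occ-y occ-y' , cong₂ _+_ (P.trans occ-x occ-t) occ-x'
split-one δ (t · u) m eq | suc n with split-one δ t n occ-t | split-none δ u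
...   | t' , sp , occ-y , occ-x | u' , sp' , occ-y' , occ-x' =
  t' · u' , sp · sp' , cong₂ _+_ occ-y occ-y' , P.trans (cong₂ _+_ occ-x occ-x') (suc-injective eq)
split-one δ (jmp t u) m eq with occ (suc δ) t in occ-t
... | zero with split-none (suc δ) t | split-one δ u m eq
...   | t' , sp , occ-y , occ-x | u' , sp' , occ-y' , occ-x' =
  jmp t' u' , jmp sp sp' , cong₂ _+_ occ-y occ-y' , cong₂ _+_ (P.trans occ-x occ-t) occ-x'
split-one δ (jmp t u) m eq | suc n with split-one (suc δ) t n occ-t | split-none δ u
...   | t' , sp , occ-y , occ-x | u' , sp' , occ-y' , occ-x' =
  jmp t' u' , jmp sp sp' , cong₂ _+_ occ-y occ-y' , P.trans (cong₂ _+_ occ-x occ-x') (suc-injective eq)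

-- merge δ identifies the inserted variable δ + 1 with δ again.
merge : ℕ → ℕ → ℕ
merge zero    zero    = zero
merge zero    (suc x) = x
merge (suc δ) x       = ext (merge δ) x

merge-< : ∀ δ x → x < δ → merge δ x ≡ x
merge-< (suc δ) zero    _         = refl
merge-< (suc δ) (suc x) (s≤s x<δ) = cong suc (merge-< δ x x<δ)

merge-≡ : ∀ δ → merge δ δ ≡ δ
merge-≡ zero    = refl
merge-≡ (suc δ) = cong suc (merge-≡ δ)

merge-suc : ∀ δ → merge δ (suc δ) ≡ δ
merge-suc zero    = refl
merge-suc (suc δ) = cong suc (merge-suc δ)

merge-> : ∀ δ x → δ < x → merge δ (suc x) ≡ x
merge-> zero    x       _         = refl
merge-> (suc δ) (suc x) (s≤s δ<x) = cong suc (merge-> δ x δ<x)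

ren-merge-Split : ∀ {δ t t'} → Split δ t t' → ren (merge δ) t' ≡ t
ren-merge-Split {δ} (var< {x} x<δ) = cong var (merge-< δ x x<δ)
ren-merge-Split {δ} varx           = cong var (merge-≡ δ)
ren-merge-Split {δ} vary           = cong var (merge-suc δ)
ren-merge-Split {δ} (var> {x} δ<x) = cong var (merge-> δ x δ<x)
ren-merge-Split (ƛ sp)             = cong ƛ_ (ren-merge-Split sp)
ren-merge-Split (sp · sp')         = cong₂ _·_ (ren-merge-Split sp) (ren-merge-Split sp')
ren-merge-Split (jmp sp sp')       = cong₂ jmp (ren-merge-Split sp) (ren-merge-Split sp')

[]₀-shift-[]₀ : ∀ t u → t [ shift 1 u ]₀ [ u ]₀ ≡ ren (merge 0) t [ u ]₀
[]₀-shift-[]₀ t u = P.trans (subst-subst (σ₀ u) (σ₀ (shift 1 u)) t)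
  (P.trans (subst-cong (λ { zero → shift-[]₀ u u ; (suc zero) → refl ; (suc (suc x)) → refl }) t)
           (P.sym (subst-ren (σ₀ u) (merge 0) t)))

occ-[]₀-shift : ∀ t u → occ 0 (t [ shift 1 u ]₀) ≡ occ 1 t
occ-[]₀-shift t u = occ-subst 0 1 (λ { zero → occ-ren-avoid (λ _ ()) u ; (suc x) → refl }) t

infix 4 _⟶*_
_⟶*_ : Tm → Tm → Set
_⟶*_ = Star _⟶_

ƛ-⟶* : ∀ {t t'} → t ⟶* t' → ƛ t ⟶* ƛ t'
ƛ-⟶* = gmap ƛ_ ƛ_

·-⟶* : ∀ {t t' u u'} → t ⟶* t' → u ⟶* u' → t · u ⟶* t' · u'
·-⟶* {t' = t'} {u} r r' = gmap (_· u) appL r ◅◅ gmap (t' ·_) appR r'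

jmp-⟶* : ∀ {t t' u u'} → t ⟶* t' → u ⟶* u' → jmp t u ⟶* jmp t' u'
jmp-⟶* {t' = t'} {u} r r' = gmap (λ z → jmp z u) jmpL r ◅◅ gmap (jmp t') jmpR r'

jmp-⟶*-[]₀-occ : ∀ n t u → occ 0 t ≡ n → jmp t u ⟶* t [ u ]₀
jmp-⟶*-[]₀-OneSplit : ∀ n {t} u → occ 0 t ≡ suc n → OneSplit 0 t n → jmp t u ⟶* t [ u ]₀

jmp-⟶*-[]₀-occ zero    t u occ-x = root (w u occ-x) ◅ ε
jmp-⟶*-[]₀-occ (suc n) t u occ-x = jmp-⟶*-[]₀-OneSplit n u occ-x (split-one 0 t n occ-x)

-- (c) moves one occurrence of x to a fresh y; the remaining n occurrences of x
-- are eliminated recursively, and then y by (d).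
jmp-⟶*-[]₀-OneSplit zero    u occ-x _ = root (d u occ-x) ◅ ε
jmp-⟶*-[]₀-OneSplit (suc m) {t} u occ-x (t' , sp , occ-y' , occ-x') =
  root (c u (P.subst (1 <_) (P.sym occ-x) (s≤s (s≤s z≤n))) sp
            (≤-reflexive (P.sym occ-y')) (P.subst (1 ≤_) (P.sym occ-x') (s≤s z≤n)))
  ◅ jmp-⟶* (jmp-⟶*-[]₀-occ (suc m) t' (shift 1 u) occ-x') ε
  ◅◅ P.subst (jmp (t' [ shift 1 u ]₀) u ⟶*_) merged (root (d u (P.trans (occ-[]₀-shift t' u) occ-y')) ◅ ε)
  where
  merged : t' [ shift 1 u ]₀ [ u ]₀ ≡ t [ u ]₀
  merged = P.trans ([]₀-shift-[]₀ t' u) (cong (_[ u ]₀) (ren-merge-Split sp))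

jmp-⟶*-[]₀ : ∀ t u → jmp t u ⟶* t [ u ]₀
jmp-⟶*-[]₀ t u = jmp-⟶*-[]₀-occ (occ 0 t) t u refl

unfold : Tm → Tm
unfold (var x)   = var x
unfold (ƛ t)     = ƛ unfold t
unfold (t · u)   = unfold t · unfold u
unfold (jmp t u) = unfold t [ unfold u ]₀

⟶*-unfold : ∀ t → t ⟶* unfold t
⟶*-unfold (var x)   = ε
⟶*-unfold (ƛ t)     = ƛ-⟶* (⟶*-unfold t)
⟶*-unfold (t · u)   = ·-⟶* (⟶*-unfold t) (⟶*-unfold u)
⟶*-unfold (jmp t u) = jmp-⟶* (⟶*-unfold t) (⟶*-unfold u) ◅◅ jmp-⟶*-[]₀ (unfold t) (unfold u)

unfold-ren : ∀ ρ t → unfold (ren ρ t) ≡ ren ρ (unfold t)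
unfold-ren ρ (var x)   = refl
unfold-ren ρ (ƛ t)     = cong ƛ_ (unfold-ren (ext ρ) t)
unfold-ren ρ (t · u)   = cong₂ _·_ (unfold-ren ρ t) (unfold-ren ρ u)
unfold-ren ρ (jmp t u) = P.trans (cong₂ _[_]₀ (unfold-ren (ext ρ) t) (unfold-ren ρ u))
                                 (P.sym (ren-[]₀ ρ (unfold t) (unfold u)))

unfold-exts : ∀ σ x → unfold (exts σ x) ≡ exts (unfold ∘ σ) x
unfold-exts σ zero    = refl
unfold-exts σ (suc x) = unfold-ren suc (σ x)

unfold-subst : ∀ σ t → unfold (subst σ t) ≡ subst (unfold ∘ σ) (unfold t)
unfold-subst σ (var x)   = refl
unfold-subst σ (ƛ t)     =
  cong ƛ_ (P.trans (unfold-subst (exts σ) t) (subst-cong (unfold-exts σ) (unfold t)))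
unfold-subst σ (t · u)   = cong₂ _·_ (unfold-subst σ t) (unfold-subst σ u)
unfold-subst σ (jmp t u) = P.trans
  (cong₂ _[_]₀ (P.trans (unfold-subst (exts σ) t) (subst-cong (unfold-exts σ) (unfold t)))
               (unfold-subst σ u))
  (P.sym (subst-[]₀ (unfold ∘ σ) (unfold t) (unfold u)))

unfold-[]₀ : ∀ t u → unfold (t [ u ]₀) ≡ unfold t [ unfold u ]₀
unfold-[]₀ t u = P.trans (unfold-subst (σ₀ u) t) (subst-cong (λ { zero → refl ; (suc x) → refl }) (unfold t))

-- Parallel β-reduction

infix 4 _⇛_ _⇛*_
data _⇛_ : Tm → Tm → Set where
  pvar : ∀ {x} → var x ⇛ var x
  pƛ   : ∀ {t t'} → t ⇛ t' → ƛ t ⇛ ƛ t'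
  papp : ∀ {t t' u u'} → t ⇛ t' → u ⇛ u' → t · u ⇛ t' · u'
  pjmp : ∀ {t t' u u'} → t ⇛ t' → u ⇛ u' → jmp t u ⇛ jmp t' u'
  pβ   : ∀ {t t' u u'} → t ⇛ t' → u ⇛ u' → (ƛ t) · u ⇛ t' [ u' ]₀

_⇛*_ : Tm → Tm → Set
_⇛*_ = Star _⇛_

⇛-refl : ∀ {t} → t ⇛ t
⇛-refl {var x}   = pvar
⇛-refl {ƛ t}     = pƛ ⇛-refl
⇛-refl {t · u}   = papp ⇛-refl ⇛-refl
⇛-refl {jmp t u} = pjmp ⇛-refl ⇛-refl

⇛-ren : ∀ ρ {t t'} → t ⇛ t' → ren ρ t ⇛ ren ρ t'
⇛-ren ρ pvar       = pvar
⇛-ren ρ (pƛ p)     = pƛ (⇛-ren (ext ρ) p)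
⇛-ren ρ (papp p q) = papp (⇛-ren ρ p) (⇛-ren ρ q)
⇛-ren ρ (pjmp p q) = pjmp (⇛-ren (ext ρ) p) (⇛-ren ρ q)
⇛-ren ρ (pβ {t' = t'} {u' = u'} p q) =
  P.subst (_ ⇛_) (P.sym (ren-[]₀ ρ t' u')) (pβ (⇛-ren (ext ρ) p) (⇛-ren ρ q))

⇛-exts : ∀ {σ σ'} → (∀ x → σ x ⇛ σ' x) → ∀ x → exts σ x ⇛ exts σ' x
⇛-exts h zero    = pvar
⇛-exts h (suc x) = ⇛-ren suc (h x)

⇛-subst : ∀ {σ σ'} → (∀ x → σ x ⇛ σ' x) → ∀ {t t'} → t ⇛ t' → subst σ t ⇛ subst σ' t'
⇛-subst h pvar       = h _
⇛-subst h (pƛ p)     = pƛ (⇛-subst (⇛-exts h) p)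
⇛-subst h (papp p q) = papp (⇛-subst h p) (⇛-subst h q)
⇛-subst h (pjmp p q) = pjmp (⇛-subst (⇛-exts h) p) (⇛-subst h q)
⇛-subst {σ' = σ'} h (pβ {t' = t'} {u' = u'} p q) =
  P.subst (_ ⇛_) (P.sym (subst-[]₀ σ' t' u')) (pβ (⇛-subst (⇛-exts h) p) (⇛-subst h q))

⇛-[]₀ : ∀ {t t' u u'} → t ⇛ t' → u ⇛ u' → t [ u ]₀ ⇛ t' [ u' ]₀
⇛-[]₀ p q = ⇛-subst (λ { zero → q ; (suc x) → pvar }) p

-- Takahashi's complete development.
develop : Tm → Tm
develop (var x)          = var x
develop (ƛ t)            = ƛ develop t
develop (var x · u)      = var x · develop u
develop ((ƛ t) · u)      = develop t [ develop u ]₀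
develop ((t₁ · t₂) · u)  = develop (t₁ · t₂) · develop u
develop (jmp t₁ t₂ · u)  = develop (jmp t₁ t₂) · develop u
develop (jmp t u)        = jmp (develop t) (develop u)

⇛-develop : ∀ {t s} → t ⇛ s → s ⇛ develop t
⇛-develop pvar                    = pvar
⇛-develop (pƛ p)                  = pƛ (⇛-develop p)
⇛-develop (papp pvar q)           = papp pvar (⇛-develop q)
⇛-develop (papp (pƛ p) q)         = pβ (⇛-develop p) (⇛-develop q)
⇛-develop (papp p@(papp _ _) q)   = papp (⇛-develop p) (⇛-develop q)
⇛-develop (papp p@(pβ _ _) q)     = papp (⇛-develop p) (⇛-develop q)
⇛-develop (papp p@(pjmp _ _) q)   = papp (⇛-develop p) (⇛-develop q)
⇛-develop (pβ p q)                = ⇛-[]₀ (⇛-develop p) (⇛-develop q)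
⇛-develop (pjmp p q)              = pjmp (⇛-develop p) (⇛-develop q)

⇛-strip : ∀ {t a b} → t ⇛ a → t ⇛* b → ∃[ v ] (a ⇛* v × b ⇛ v)
⇛-strip {a = a} p ε = a , ε , p
⇛-strip p (q ◅ qs) with ⇛-strip (⇛-develop q) qs
... | v , develop-t⇛*v , b⇛v = v , ⇛-develop p ◅ develop-t⇛*v , b⇛v

⇛*-confluent : ∀ {t a b} → t ⇛* a → t ⇛* b → ∃[ v ] (a ⇛* v × b ⇛* v)
⇛*-confluent {b = b} ε q = b , q , ε
⇛*-confluent (p ◅ ps) q with ⇛-strip p q
... | v₁ , a₁⇛*v₁ , b⇛v₁ with ⇛*-confluent ps a₁⇛*v₁
... | v , a⇛*v , v₁⇛*v = v , a⇛*v , b⇛v₁ ◅ v₁⇛*v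

⇛⇒⟶* : ∀ {t t'} → t ⇛ t' → t ⟶* t'
⇛⇒⟶* pvar       = ε
⇛⇒⟶* (pƛ p)     = ƛ-⟶* (⇛⇒⟶* p)
⇛⇒⟶* (papp p q) = ·-⟶* (⇛⇒⟶* p) (⇛⇒⟶* q)
⇛⇒⟶* (pjmp p q) = jmp-⟶* (⇛⇒⟶* p) (⇛⇒⟶* q)
⇛⇒⟶* (pβ {t' = t'} {u' = u'} p q) =
  ·-⟶* (ƛ-⟶* (⇛⇒⟶* p)) (⇛⇒⟶* q)
  ◅◅ P.subst (λ z → (ƛ t') · u' ⟶ jmp t' z) (ren-id (λ _ → refl) u') (root (dB [] t' u'))
  ◅ jmp-⟶*-[]₀ t' u'

⇛*⇒⟶* : ∀ {t t'} → t ⇛* t' → t ⟶* t'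
⇛*⇒⟶* ε        = ε
⇛*⇒⟶* (p ◅ ps) = ⇛⇒⟶* p ◅◅ ⇛*⇒⟶* ps

-- Projecting λj/E onto parallel β

jumpsSubst : List Tm → ℕ → Tm
jumpsSubst []       = var
jumpsSubst (s ∷ L)  = subst (jumpsSubst L) ∘ σ₀ (unfold s)

unfold-wrap : ∀ L t → unfold (wrap L t) ≡ subst (jumpsSubst L) (unfold t)
unfold-wrap []       t = P.sym (subst-id (λ _ → refl) (unfold t))
unfold-wrap (s ∷ L)  t = P.trans (unfold-wrap L (jmp t s)) (subst-subst (jumpsSubst L) (σ₀ (unfold s)) (unfold t))

jumpsSubst-shift : ∀ L t → subst (jumpsSubst L) (shift (length L) t) ≡ t
jumpsSubst-shift L t = P.trans (subst-ren (jumpsSubst L) (length L +_) t) (subst-id (beyond L) t)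
  where
  beyond : ∀ L x → jumpsSubst L (length L + x) ≡ var x
  beyond []       x = refl
  beyond (_ ∷ L)  x = beyond L x

↦⇒⇛ : ∀ {t u} → t ↦ u → unfold t ⇛ unfold u
↦⇒⇛ (dB L t u) = P.subst₂ _⇛_ (cong (_· unfold u) (P.sym (unfold-wrap L (ƛ t)))) (P.sym reduct) (pβ ⇛-refl ⇛-refl)
  where
  open ≡-Reasoning
  reduct : unfold (wrap L (jmp t (shift (length L) u))) ≡ subst (exts (jumpsSubst L)) (unfold t) [ unfold u ]₀
  reduct = begin
    unfold (wrap L (jmp t (shift (length L) u)))
      ≡⟨ unfold-wrap L (jmp t (shift (length L) u)) ⟩
    subst (jumpsSubst L) (unfold t [ unfold (shift (length L) u) ]₀)
      ≡⟨ cong (λ z → subst (jumpsSubst L) (unfold t [ z ]₀)) (unfold-ren (length L +_) u) ⟩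
    subst (jumpsSubst L) (unfold t [ shift (length L) (unfold u) ]₀)
      ≡⟨ subst-[]₀ (jumpsSubst L) (unfold t) (shift (length L) (unfold u)) ⟩
    subst (exts (jumpsSubst L)) (unfold t) [ subst (jumpsSubst L) (shift (length L) (unfold u)) ]₀
      ≡⟨ cong (subst (exts (jumpsSubst L)) (unfold t) [_]₀) (jumpsSubst-shift L (unfold u)) ⟩
    subst (exts (jumpsSubst L)) (unfold t) [ unfold u ]₀
      ∎
↦⇒⇛ (w {t} u _) = P.subst (unfold t [ unfold u ]₀ ⇛_) (P.sym (unfold-[]₀ t u)) ⇛-refl
↦⇒⇛ (d {t} u _) = P.subst (unfold t [ unfold u ]₀ ⇛_) (P.sym (unfold-[]₀ t u)) ⇛-refl
↦⇒⇛ (c {t} {t'} u _ sp _ _) = P.subst (unfold t [ unfold u ]₀ ⇛_) (P.sym merged) ⇛-refl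
  where
  open ≡-Reasoning
  merged : unfold t' [ unfold (shift 1 u) ]₀ [ unfold u ]₀ ≡ unfold t [ unfold u ]₀
  merged = begin
    unfold t' [ unfold (shift 1 u) ]₀ [ unfold u ]₀ ≡⟨ cong (λ z → unfold t' [ z ]₀ [ unfold u ]₀) (unfold-ren suc u) ⟩
    unfold t' [ shift 1 (unfold u) ]₀ [ unfold u ]₀ ≡⟨ []₀-shift-[]₀ (unfold t') (unfold u) ⟩
    ren (merge 0) (unfold t') [ unfold u ]₀         ≡⟨ cong (_[ unfold u ]₀) (unfold-ren (merge 0) t') ⟨
    unfold (ren (merge 0) t') [ unfold u ]₀         ≡⟨ cong (λ z → unfold z [ unfold u ]₀) (ren-merge-Split sp) ⟩
    unfold t [ unfold u ]₀                          ∎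

⟶⇒⇛ : ∀ {t u} → t ⟶ u → unfold t ⇛ unfold u
⟶⇒⇛ (root r)     = ↦⇒⇛ r
⟶⇒⇛ (ƛ r)        = pƛ (⟶⇒⇛ r)
⟶⇒⇛ (appL r)     = papp (⟶⇒⇛ r) ⇛-refl
⟶⇒⇛ (appR r)     = papp ⇛-refl (⟶⇒⇛ r)
⟶⇒⇛ (jmpL r)     = ⇛-[]₀ (⟶⇒⇛ r) ⇛-refl
⟶⇒⇛ (jmpR {t} r) = ⇛-[]₀ (⇛-refl {unfold t}) (⟶⇒⇛ r)

Axiom⇒unfold≡ : ∀ {k t u} → Axiom k t u → unfold t ≡ unfold u
Axiom⇒unfold≡ (cs t s v) = begin
  unfold t [ unfold (shift 1 s) ]₀ [ unfold v ]₀
    ≡⟨ cong (λ z → unfold t [ z ]₀ [ unfold v ]₀) (unfold-ren suc s) ⟩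
  unfold t [ shift 1 (unfold s) ]₀ [ unfold v ]₀
    ≡⟨ []₀-[]₀-swap (unfold t) (unfold s) (unfold v) ⟩
  swap (unfold t) [ shift 1 (unfold v) ]₀ [ unfold s ]₀
    ≡⟨ cong₂ (λ a b → a [ b ]₀ [ unfold s ]₀) (unfold-ren swapV t) (unfold-ren suc v) ⟨
  unfold (swap t) [ unfold (shift 1 v) ]₀ [ unfold s ]₀
    ∎
  where open ≡-Reasoning
Axiom⇒unfold≡ (lam t s) = cong ƛ_ (begin
  unfold t [ unfold (shift 1 s) ]₀                  ≡⟨ cong (unfold t [_]₀) (unfold-ren suc s) ⟩
  unfold t [ shift 1 (unfold s) ]₀                  ≡⟨ []₀-shift-swap (unfold t) (unfold s) ⟩
  subst (exts (σ₀ (unfold s))) (swap (unfold t))    ≡⟨ cong (subst (exts (σ₀ (unfold s)))) (unfold-ren swapV t) ⟨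
  subst (exts (σ₀ (unfold s))) (unfold (swap t))    ∎)
  where open ≡-Reasoning
Axiom⇒unfold≡ (app t s v) = cong (unfold t [ unfold s ]₀ ·_)
  (P.sym (P.trans (cong (_[ unfold s ]₀) (unfold-ren suc v)) (shift-[]₀ (unfold v) (unfold s))))

Equiv⇒unfold≡ : ∀ {k t u} → Equiv k t u → unfold t ≡ unfold u
Equiv⇒unfold≡ (ax a)           = Axiom⇒unfold≡ a
Equiv⇒unfold≡ refl             = refl
Equiv⇒unfold≡ (sym e)          = P.sym (Equiv⇒unfold≡ e)
Equiv⇒unfold≡ (trans e e')     = P.trans (Equiv⇒unfold≡ e) (Equiv⇒unfold≡ e')
Equiv⇒unfold≡ (ƛ e)            = cong ƛ_ (Equiv⇒unfold≡ e)
Equiv⇒unfold≡ (appL {u = u} e) = cong (_· unfold u) (Equiv⇒unfold≡ e)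
Equiv⇒unfold≡ (appR {t = t} e) = cong (unfold t ·_) (Equiv⇒unfold≡ e)
Equiv⇒unfold≡ (jmpL {u = u} e) = cong (_[ unfold u ]₀) (Equiv⇒unfold≡ e)
Equiv⇒unfold≡ (jmpR {t = t} e) = cong (unfold t [_]₀) (Equiv⇒unfold≡ e)

⟶*[]⇒⇛* : ∀ {k t u} → t ⟶*[ k ] u → unfold t ⇛* unfold u
⟶*[]⇒⇛* ε = ε
⟶*[]⇒⇛* ((_ , _ , e , r , e') ◅ rs) =
  P.subst₂ _⇛_ (P.sym (Equiv⇒unfold≡ e)) (Equiv⇒unfold≡ e') (⟶⇒⇛ r) ◅ ⟶*[]⇒⇛* rs

⟶*⇒⟶*[] : ∀ {k t u} → t ⟶* u → t ⟶*[ k ] u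
⟶*⇒⟶*[] = gmap (λ t → t) (λ r → _ , _ , refl , r , refl)

unfold-⇛*⇒⟶*[] : ∀ {k u v} → unfold u ⇛* v → u ⟶*[ k ] v
unfold-⇛*⇒⟶*[] {u = u} p = ⟶*⇒⟶*[] (⟶*-unfold u ◅◅ ⇛*⇒⟶* p)

theorem4p4 : (E : Kind) (t₀ t₁ u₀ u₁ : Tm) →
    Equiv E t₀ t₁ → t₀ ⟶*[ E ] u₀ → t₁ ⟶*[ E ] u₁ →
    ∃[ v₀ ] ∃[ v₁ ] (u₀ ⟶*[ E ] v₀ × u₁ ⟶*[ E ] v₁ × Equiv E v₀ v₁)
theorem4p4 E t₀ t₁ u₀ u₁ t₀≈t₁ t₀↠u₀ t₁↠u₁
  with ⇛*-confluent (⟶*[]⇒⇛* t₀↠u₀) (P.subst (_⇛* unfold u₁) (P.sym (Equiv⇒unfold≡ t₀≈t₁)) (⟶*[]⇒⇛* t₁↠u₁))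
... | v , u₀⇛*v , u₁⇛*v = v , v , unfold-⇛*⇒⟶*[] u₀⇛*v , unfold-⇛*⇒⟶*[] u₁⇛*v , refl
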